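{- Let $n \ge 1$ and let $G_n$ be the graph with vertex set $\mathbb{Z}^n$ in which $u,v$ are adjacent iff $\|u-v\|_\infty = 1$. Let $S \subset \mathbb{Z}^n$ be a finite set such that $\mathrm{gap}_\epsilon(S) = \emptyset$ for every nonzero $\epsilon \in \{ -1,0,1\}^n$. Then $$|\partial_e(S)| = \sum_{\epsilon \in \{ -1,0,1\}^n,\ \epsilon \neq 0} |P_\epsilon(S)|.$$
   Context: Edges are unordered pairs. For $A \subset \mathbb{Z}^n$, the edge boundary is $\partial_e(A) = \{\{x,y\} : \|x-y\|_\infty = 1,\ |A \cap \{x,y\}| = 1\}$. For nonzero $\epsilon \in \{ -1,0,1\}^n$, $P_\epsilon(S)$ is the orthogonal projection of $S$ onto the hyperplane $\epsilon^\perp$, i.e. $P_\epsilon(S) = \{u - \frac{\langle u,\epsilon\rangle}{\|\epsilon\|_2^2}\epsilon : u \in S\}$. Also $\mathrm{gap}_\epsilon(S) = \{x \in \mathbb{Z}^n : x - \epsilon \in S,\ x \notin S,\ \text{and } x + b\epsilon \in S \text{ for some integer } b \ge 1\}$. -}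

module Defs where

open import Data.Nat as ℕ using (ℕ; zero; suc)
open import Data.Integer as ℤ using (ℤ; +_; -[1+_]; ∣_∣; _≟_)
open import Data.Rational as ℚ using (ℚ)
open import Data.Vec using (Vec; []; _∷_; zipWith; map; foldr)
open import Data.Vec.Relation.Unary.All as VAll using (All; all?)
open import Data.List as List using (List; length; filter; concatMap)
open import Data.List.Membership.Propositional using (_∈_)
open import Data.List.Relation.Unary.Unique.Propositional using (Unique)
open import Data.Product using (Σ; ∃; _×_)
open import Data.Sum using (_⊎_)
open import Function.Bundles using (_⇔_)
open import Relation.Nullary using (¬_; ¬?)
open import Relation.Binary.PropositionalEquality using (_≡_)

Pt : ℕ → Set
Pt n = Vec ℤ n

_⊕_ : ∀ {n} → Pt n → Pt n → Pt n
_⊕_ = zipWith ℤ._+_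

_⊖_ : ∀ {n} → Pt n → Pt n → Pt n
_⊖_ = zipWith ℤ._-_

_·_ : ∀ {n} → ℤ → Pt n → Pt n
b · v = map (b ℤ.*_) v

supNorm : ∀ {n} → Pt n → ℕ
supNorm = foldr _ (λ a r → ∣ a ∣ ℕ.⊔ r) 0

Adj : ∀ {n} → Pt n → Pt n → Set
Adj x y = supNorm (x ⊖ y) ≡ 1

-- a finite set S ⊂ ℤ^n is given by a list enumerating it; membership is list membership
-- Edge boundary ∂_e(S): each unordered edge {x,y} with exactly one endpoint in S is
-- represented by its unique orientation (x,y) with x ∈ S, y ∉ S.
InEdgeBoundary : ∀ {n} → List (Pt n) → Pt n × Pt n → Set
InEdgeBoundary S (x Data.Product., y) = Adj x y × x ∈ S × ¬ (y ∈ S)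

Trit : ℤ → Set
Trit a = (a ≡ -[1+ 0 ]) ⊎ (a ≡ + 0) ⊎ (a ≡ + 1)

IsZeroVec : ∀ {n} → Pt n → Set
IsZeroVec = All (_≡ + 0)

Dir : ∀ {n} → Pt n → Set
Dir ε = All Trit ε × ¬ IsZeroVec ε

InGap : ∀ {n} → Pt n → List (Pt n) → Pt n → Set
InGap ε S x = ((x ⊖ ε) ∈ S) × ¬ (x ∈ S) × ∃ λ (b : ℕ) → (1 ℕ.≤ b) × ((x ⊕ ((+ b) · ε)) ∈ S)

dot : ∀ {n} → Pt n → Pt n → ℤ
dot u v = foldr _ ℤ._+_ (+ 0) (zipWith ℤ._*_ u v)

normSq : ∀ {n} → Pt n → ℕ
normSq ε = ∣ dot ε ε ∣

-- a / d as a rational (d = 0 never occurs for nonzero ε)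
divℚ : ℤ → ℕ → ℚ
divℚ a zero = ℚ.0ℚ
divℚ a (suc d) = a ℚ./ suc d

proj : ∀ {n} → Pt n → Pt n → Vec ℚ n
proj ε u = zipWith (λ ui εi → (ui ℚ./ 1) ℚ.- (c ℚ.* (εi ℚ./ 1))) u ε
  where c = divℚ (dot u ε) (normSq ε)

InProj : ∀ {n} → Pt n → List (Pt n) → Vec ℚ n → Set
InProj ε S q = ∃ λ u → u ∈ S × proj ε u ≡ q

HasSize : {A : Set} → (A → Set) → ℕ → Set
HasSize {A} P k = Σ (List A) λ l → Unique l × (∀ x → (x ∈ l) ⇔ P x) × length l ≡ k

tritVecs : (n : ℕ) → List (Pt n)
tritVecs zero = [] List.∷ List.[]
tritVecs (suc n) = concatMap (λ v → (-[1+ 0 ] ∷ v) List.∷ (+ 0 ∷ v) List.∷ (+ 1 ∷ v) List.∷ List.[]) (tritVecs n)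

nonzeroDirs : (n : ℕ) → List (Pt n)
nonzeroDirs n = filter (λ v → ¬? (all? (_≟ + 0) v)) (tritVecs n)

-- For a nonzero direction ε ∈ {-1,0,1}ⁿ call x an ε-exit of S when x ∈ S but
-- x + ε ∉ S.  Two facts give the formula |∂ₑ S| = Σ_ε |P_ε(S)|:
--
-- * Every boundary edge {x,y} (x ∈ S, y ∉ S) is (x, x + ε) for exactly one
--   direction ε = y − x, and x is then an ε-exit.  So the boundary edges are
--   the disjoint union over ε of the ε-exits, and |∂ₑ S| = Σ_ε |exits_ε(S)|.
-- * P_ε maps the ε-exits bijectively onto P_ε(S).  Onto: walking from u ∈ S in
--   direction ε one must leave the finite set S, and P_ε is constant along the
--   walk.  One-to-one: P_ε u = P_ε v forces v = u + tε; two distinct exits on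
--   one such line would put a point of gap_ε(S) between them.
module Submission where

open import Defs
open import Data.Nat using (ℕ; _≤_)
open import Data.List using (List; map)
open import Data.Nat.ListAction using (sum)
open import Data.List.Membership.Propositional using (_∈_)
open import Data.Product using (Σ; ∃; _×_)
open import Relation.Nullary using (¬_)
open import Relation.Binary.PropositionalEquality using (_≡_)

open import Function using (_∘_)
open import Function.Bundles using (_⇔_; mk⇔)
open import Data.Empty using (⊥-elim)
open import Data.Product using (_,_; proj₁; proj₂)
open import Data.Sum using (inj₁; inj₂)
open import Relation.Nullary using (Dec; yes; no; ¬?)
open import Relation.Binary.PropositionalEquality
  using (refl; sym; trans; cong; cong₂; subst; module ≡-Reasoning)
open import Data.Nat as ℕ using (zero; suc; z≤n; s≤s)
import Data.Nat.Properties as ℕP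
open import Data.Integer as ℤ using (ℤ; +_; -[1+_]; ∣_∣)
import Data.Integer.Properties as ℤP
open import Data.Integer.Tactic.RingSolver using (solve-∀)
open import Data.Rational as ℚ using (toℚᵘ)
open import Data.Rational.Unnormalised as ℚᵘ using (mkℚᵘ; *≡*)
import Data.Rational.Unnormalised.Properties as ℚᵘP
import Data.Rational.Properties as ℚP
open import Data.Vec as Vec using ([]; _∷_; zipWith)
open import Data.Vec.Properties using (∷-injective; ≡-dec)
open import Data.Vec.Relation.Unary.All using (All; []; _∷_; all?)
open import Data.List as List using ([]; _∷_; concatMap; filter; deduplicate; length)
open import Data.List.Properties using (length-++; length-map; map-cong)
open import Data.List.Relation.Unary.All as ListAll using ([]; _∷_)
import Data.List.Relation.Unary.All.Properties as ListAllP
open import Data.List.Relation.Unary.AllPairs using ([]; _∷_)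
open import Data.List.Relation.Unary.Any as Any using (here; there)
open import Data.List.Relation.Unary.Unique.Propositional using (Unique)
import Data.List.Relation.Unary.Unique.Propositional.Properties as UniqueP
open import Data.List.Membership.Propositional using (find)
open import Data.List.Membership.Propositional.Properties
  using (∈-map⁺; ∈-map⁻; ∈-concatMap⁺; ∈-concatMap⁻; ∈-filter⁺; ∈-filter⁻;
         ∈-deduplicate⁺; ∈-deduplicate⁻)

module _ {A B : Set} where

  -- A map injective on the elements of a duplicate-free list keeps it
  -- duplicate-free (the library version asks for global injectivity).
  map-unique : (f : A → B) {xs : List A} → Unique xs
             → (∀ {x y} → x ∈ xs → y ∈ xs → f x ≡ f y → x ≡ y)
             → Unique (map f xs)
  map-unique f {[]} [] _ = []
  map-unique f {x ∷ xs} (x∉xs ∷ xs!) inj =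
    ListAllP.map⁺ (ListAll.tabulate λ y∈xs fx≡fy →
      ListAll.lookup x∉xs y∈xs (inj (here refl) (there y∈xs) fx≡fy))
    ∷ map-unique f xs! (λ x∈ y∈ → inj (there x∈) (there y∈))

  concatMap-unique : (f : A → List B) {xs : List A} → Unique xs
                   → (∀ x → Unique (f x))
                   → (∀ {x y b} → b ∈ f x → b ∈ f y → x ≡ y)
                   → Unique (concatMap f xs)
  concatMap-unique f {[]} [] _ _ = []
  concatMap-unique f {x ∷ xs} (x∉xs ∷ xs!) f! owner =
    UniqueP.++⁺ (f! x) (concatMap-unique f xs! f! owner) disjoint
    where
    disjoint : ∀ {b} → ¬ (b ∈ f x × b ∈ concatMap f xs)
    disjoint (b∈fx , b∈rest) with find (∈-concatMap⁻ f {xs = xs} b∈rest)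
    ... | y , y∈xs , b∈fy = ListAll.lookup x∉xs y∈xs (owner b∈fx b∈fy)

  length-concatMap : (f : A → List B) (xs : List A)
                   → length (concatMap f xs) ≡ sum (map (length ∘ f) xs)
  length-concatMap f [] = refl
  length-concatMap f (x ∷ xs) =
    trans (length-++ (f x)) (cong (length (f x) ℕ.+_) (length-concatMap f xs))

member≤sum : {A : Set} (f : A → ℕ) {v : A} (xs : List A) → v ∈ xs → f v ℕ.≤ sum (map f xs)
member≤sum f (x ∷ xs) (here refl) = ℕP.m≤m+n (f x) _
member≤sum f (x ∷ xs) (there v∈) = ℕP.≤-trans (member≤sum f xs v∈) (ℕP.m≤n+m _ (f x))

_+[_]_ : ∀ {m} → Pt m → ℤ → Pt m → Pt m
x +[ t ] e = x ⊕ (t · e)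

⊕-⊖-cancel : ∀ {m} (x e : Pt m) → (x ⊕ e) ⊖ e ≡ x
⊕-⊖-cancel [] [] = refl
⊕-⊖-cancel (x ∷ xs) (e ∷ es) = cong₂ _∷_ (identity x e) (⊕-⊖-cancel xs es)
  where identity : ∀ x e → (x ℤ.+ e) ℤ.- e ≡ x
        identity = solve-∀

⊕-⊖-difference : ∀ {m} (x y : Pt m) → x ⊕ (y ⊖ x) ≡ y
⊕-⊖-difference [] [] = refl
⊕-⊖-difference (x ∷ xs) (y ∷ ys) = cong₂ _∷_ (identity x y) (⊕-⊖-difference xs ys)
  where identity : ∀ x y → x ℤ.+ (y ℤ.- x) ≡ y
        identity = solve-∀

⊕-⊖-direction : ∀ {m} (x e : Pt m) → (x ⊕ e) ⊖ x ≡ e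
⊕-⊖-direction [] [] = refl
⊕-⊖-direction (x ∷ xs) (e ∷ es) = cong₂ _∷_ (identity x e) (⊕-⊖-direction xs es)
  where identity : ∀ x e → (x ℤ.+ e) ℤ.- x ≡ e
        identity = solve-∀

line-zero : ∀ {m} (x e : Pt m) → x +[ + 0 ] e ≡ x
line-zero [] [] = refl
line-zero (x ∷ xs) (e ∷ es) = cong₂ _∷_ (identity x e) (line-zero xs es)
  where identity : ∀ x e → x ℤ.+ (+ 0) ℤ.* e ≡ x
        identity = solve-∀

line-step : ∀ {m} (j : ℕ) (x e : Pt m) → (x +[ + j ] e) ⊕ e ≡ x +[ + suc j ] e
line-step j [] [] = refl
line-step j (x ∷ xs) (e ∷ es) = cong₂ _∷_ (identity (+ j) x e) (line-step j xs es)
  where identity : ∀ j x e → (x ℤ.+ j ℤ.* e) ℤ.+ e ≡ x ℤ.+ (+ 1 ℤ.+ j) ℤ.* e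
        identity = solve-∀

line-from-next : ∀ {m} (j : ℕ) (x e : Pt m) → (x ⊕ e) +[ + j ] e ≡ x +[ + suc j ] e
line-from-next j [] [] = refl
line-from-next j (x ∷ xs) (e ∷ es) = cong₂ _∷_ (identity (+ j) x e) (line-from-next j xs es)
  where identity : ∀ j x e → (x ℤ.+ e) ℤ.+ j ℤ.* e ≡ x ℤ.+ (+ 1 ℤ.+ j) ℤ.* e
        identity = solve-∀

line-back : ∀ {m} (t : ℤ) (x e : Pt m) → (x +[ t ] e) +[ ℤ.- t ] e ≡ x
line-back t [] [] = refl
line-back t (x ∷ xs) (e ∷ es) = cong₂ _∷_ (identity t x e) (line-back t xs es)
  where identity : ∀ t x e → (x ℤ.+ t ℤ.* e) ℤ.+ (ℤ.- t) ℤ.* e ≡ x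
        identity = solve-∀

dot-line : ∀ {m} (u v w : Pt m) (t : ℤ) → dot (u +[ t ] v) w ≡ dot u w ℤ.+ t ℤ.* dot v w
dot-line [] [] [] t = identity t
  where identity : ∀ t → + 0 ≡ + 0 ℤ.+ t ℤ.* + 0
        identity = solve-∀
dot-line (u ∷ us) (v ∷ vs) (w ∷ ws) t =
  trans (cong (λ A → (u ℤ.+ t ℤ.* v) ℤ.* w ℤ.+ A) (dot-line us vs ws t))
        (identity u v w t (dot us ws) (dot vs ws))
  where identity : ∀ u v w t A B → (u ℤ.+ t ℤ.* v) ℤ.* w ℤ.+ (A ℤ.+ t ℤ.* B)
                                   ≡ (u ℤ.* w ℤ.+ A) ℤ.+ t ℤ.* (v ℤ.* w ℤ.+ B)
        identity = solve-∀

supNorm-⊖-comm : ∀ {m} (x y : Pt m) → supNorm (x ⊖ y) ≡ supNorm (y ⊖ x)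
supNorm-⊖-comm [] [] = refl
supNorm-⊖-comm (x ∷ xs) (y ∷ ys) = cong₂ ℕ._⊔_ (ℤP.∣i-j∣≡∣j-i∣ x y) (supNorm-⊖-comm xs ys)

Trit⇒∣∣≤1 : ∀ {a} → Trit a → ∣ a ∣ ℕ.≤ 1
Trit⇒∣∣≤1 (inj₁ refl) = s≤s z≤n
Trit⇒∣∣≤1 (inj₂ (inj₁ refl)) = z≤n
Trit⇒∣∣≤1 (inj₂ (inj₂ refl)) = s≤s z≤n

∣∣≤1⇒Trit : ∀ a → ∣ a ∣ ℕ.≤ 1 → Trit a
∣∣≤1⇒Trit (+ zero) _ = inj₂ (inj₁ refl)
∣∣≤1⇒Trit (+ suc zero) _ = inj₂ (inj₂ refl)
∣∣≤1⇒Trit -[1+ zero ] _ = inj₁ refl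
∣∣≤1⇒Trit (+ suc (suc _)) (s≤s ())
∣∣≤1⇒Trit -[1+ suc _ ] (s≤s ())

All-Trit⇒supNorm≤1 : ∀ {m} {v : Pt m} → All Trit v → supNorm v ℕ.≤ 1
All-Trit⇒supNorm≤1 [] = z≤n
All-Trit⇒supNorm≤1 (a ∷ v) = ℕP.⊔-lub (Trit⇒∣∣≤1 a) (All-Trit⇒supNorm≤1 v)

supNorm≤1⇒All-Trit : ∀ {m} (v : Pt m) → supNorm v ℕ.≤ 1 → All Trit v
supNorm≤1⇒All-Trit [] _ = []
supNorm≤1⇒All-Trit (a ∷ v) ≤1 =
  ∣∣≤1⇒Trit a (ℕP.≤-trans (ℕP.m≤m⊔n ∣ a ∣ (supNorm v)) ≤1)
  ∷ supNorm≤1⇒All-Trit v (ℕP.≤-trans (ℕP.m≤n⊔m ∣ a ∣ (supNorm v)) ≤1)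

supNorm≡0⇒IsZeroVec : ∀ {m} (v : Pt m) → supNorm v ≡ 0 → IsZeroVec v
supNorm≡0⇒IsZeroVec [] _ = []
supNorm≡0⇒IsZeroVec (a ∷ v) ≡0 =
  ℤP.∣i∣≡0⇒i≡0 (ℕP.n≤0⇒n≡0 (ℕP.≤-trans (ℕP.m≤m⊔n ∣ a ∣ (supNorm v)) (ℕP.≤-reflexive ≡0)))
  ∷ supNorm≡0⇒IsZeroVec v (ℕP.n≤0⇒n≡0 (ℕP.≤-trans (ℕP.m≤n⊔m ∣ a ∣ (supNorm v)) (ℕP.≤-reflexive ≡0)))

IsZeroVec⇒supNorm≡0 : ∀ {m} (v : Pt m) → IsZeroVec v → supNorm v ≡ 0
IsZeroVec⇒supNorm≡0 [] [] = refl
IsZeroVec⇒supNorm≡0 (a ∷ v) (refl ∷ z) = IsZeroVec⇒supNorm≡0 v z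

Dir⇒supNorm≡1 : ∀ {m} (v : Pt m) → Dir v → supNorm v ≡ 1
Dir⇒supNorm≡1 v (trits , nonzero)
  with supNorm v | All-Trit⇒supNorm≤1 trits | supNorm≡0⇒IsZeroVec v
... | zero        | _       | isZero = ⊥-elim (nonzero (isZero refl))
... | suc zero    | _       | _      = refl
... | suc (suc _) | s≤s ()  | _

supNorm≡1⇒Dir : ∀ {m} (v : Pt m) → supNorm v ≡ 1 → Dir v
supNorm≡1⇒Dir v ≡1 =
  supNorm≤1⇒All-Trit v (ℕP.≤-reflexive ≡1) ,
  λ isZero → ℕP.0≢1+n (trans (sym (IsZeroVec⇒supNorm≡0 v isZero)) ≡1)

trit-selfDot : ∀ {m} (e : Pt m) → All Trit e
             → Σ ℕ λ k → dot e e ≡ + k × (k ≡ 0 → IsZeroVec e)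
trit-selfDot [] [] = 0 , refl , λ _ → []
trit-selfDot (a ∷ e) (t ∷ ts) with trit-selfDot e ts
trit-selfDot (.(-[1+ 0 ]) ∷ e) (inj₁ refl ∷ ts) | k , eq , _ =
  suc k , cong (λ s → + 1 ℤ.+ s) eq , λ ()
trit-selfDot (.(+ 0) ∷ e) (inj₂ (inj₁ refl) ∷ ts) | k , eq , zero⇒ =
  k , trans (ℤP.+-identityˡ _) eq , λ k≡0 → refl ∷ zero⇒ k≡0
trit-selfDot (.(+ 1) ∷ e) (inj₂ (inj₂ refl) ∷ ts) | k , eq , _ =
  suc k , cong (λ s → + 1 ℤ.+ s) eq , λ ()

Dir⇒selfDot-positive : ∀ {m} (e : Pt m) → Dir e → Σ ℕ λ d → dot e e ≡ + suc d
Dir⇒selfDot-positive e (trits , nonzero) with trit-selfDot e trits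
... | zero  , _  , zero⇒ = ⊥-elim (nonzero (zero⇒ refl))
... | suc d , eq , _     = d , eq

-- The projection P_ε, computed over ℤ after scaling by N = ‖ε‖²

-- N·u − a·e; with a = ⟨u,e⟩ this is N times the projection of u onto e^⊥.
scaledProj : ∀ {m} → ℤ → ℤ → Pt m → Pt m → Pt m
scaledProj N a = zipWith (λ x e → N ℤ.* x ℤ.- a ℤ.* e)

-- One coordinate of the projection, over the common denominator suc d; checked
-- in unnormalised rationals, where it is a cross-multiplication identity.
proj-coordinate : (x a e : ℤ) (d : ℕ)
  → (x ℚ./ 1) ℚ.- ((a ℚ./ suc d) ℚ.* (e ℚ./ 1)) ≡ ((+ suc d) ℤ.* x ℤ.- a ℤ.* e) ℚ./ suc d
proj-coordinate x a e d = ℚP.toℚᵘ-injective (begin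
  toℚᵘ (p ℚ.- A ℚ.* B)                       ≈⟨ ℚP.toℚᵘ-homo-+ p (ℚ.- (A ℚ.* B)) ⟩
  toℚᵘ p ℚᵘ.+ toℚᵘ (ℚ.- (A ℚ.* B))           ≈⟨ ℚᵘP.+-congʳ (toℚᵘ p) (ℚP.toℚᵘ-homo‿- (A ℚ.* B)) ⟩
  toℚᵘ p ℚᵘ.- toℚᵘ (A ℚ.* B)                 ≈⟨ ℚᵘP.+-cong (ℚP.toℚᵘ-fromℚᵘ (mkℚᵘ x 0)) (ℚᵘP.-‿cong A*B≃) ⟩
  mkℚᵘ x 0 ℚᵘ.- mkℚᵘ a d ℚᵘ.* mkℚᵘ e 0       ≈⟨ common-denominator ⟩
  mkℚᵘ ((+ suc d) ℤ.* x ℤ.- a ℤ.* e) d       ≈⟨ ℚᵘP.≃-sym (ℚP.toℚᵘ-fromℚᵘ _) ⟩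
  toℚᵘ (((+ suc d) ℤ.* x ℤ.- a ℤ.* e) ℚ./ suc d) ∎)
  where
  open ℚᵘP.≃-Reasoning
  p = x ℚ./ 1
  A = a ℚ./ suc d
  B = e ℚ./ 1
  A*B≃ : toℚᵘ (A ℚ.* B) ℚᵘ.≃ mkℚᵘ a d ℚᵘ.* mkℚᵘ e 0
  A*B≃ = ℚᵘP.≃-trans (ℚP.toℚᵘ-homo-* A B)
           (ℚᵘP.*-cong (ℚP.toℚᵘ-fromℚᵘ (mkℚᵘ a d)) (ℚP.toℚᵘ-fromℚᵘ (mkℚᵘ e 0)))
  cross-multiplied : ∀ x a e D → (x ℤ.* D ℤ.+ (ℤ.- (a ℤ.* e)) ℤ.* + 1) ℤ.* D ≡ (D ℤ.* x ℤ.- a ℤ.* e) ℤ.* D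
  cross-multiplied = solve-∀
  common-denominator : mkℚᵘ x 0 ℚᵘ.- mkℚᵘ a d ℚᵘ.* mkℚᵘ e 0 ℚᵘ.≃ mkℚᵘ ((+ suc d) ℤ.* x ℤ.- a ℤ.* e) d
  common-denominator rewrite ℕP.*-identityʳ d | ℕP.+-identityʳ d =
    *≡* (cross-multiplied x a e (+ suc d))

divide : ℕ → ∀ {m} → Pt m → Vec.Vec ℚ.ℚ m
divide d = Vec.map (λ z → z ℚ./ suc d)

proj-scaled : ∀ {m} (ε u : Pt m) (d : ℕ) → normSq ε ≡ suc d
            → proj ε u ≡ divide d (scaledProj (+ suc d) (dot u ε) u ε)
proj-scaled ε u d N≡ = coordinatewise (cong (divℚ (dot u ε)) N≡) u ε
  where
  coordinatewise : ∀ {k c} → c ≡ dot u ε ℚ./ suc d → (v e : Pt k)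
    → zipWith (λ vi ei → (vi ℚ./ 1) ℚ.- (c ℚ.* (ei ℚ./ 1))) v e
      ≡ divide d (scaledProj (+ suc d) (dot u ε) v e)
  coordinatewise _ [] [] = refl
  coordinatewise refl (x ∷ v) (e ∷ es) =
    cong₂ _∷_ (proj-coordinate x (dot u ε) e d) (coordinatewise refl v es)

divide-injective : ∀ {m} (d : ℕ) (v w : Pt m) → divide d v ≡ divide d w → v ≡ w
divide-injective d [] [] _ = refl
divide-injective d (z ∷ v) (z′ ∷ w) eq with ∷-injective eq
... | head≡ , tail≡ with ℚP.fromℚᵘ-injective {mkℚᵘ z d} {mkℚᵘ z′ d} head≡
... | *≡* cross = cong₂ _∷_ (ℤP.*-cancelʳ-≡ z z′ (+ suc d) cross) (divide-injective d v w tail≡)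

scaledProj-line : ∀ {m} N a t (u e : Pt m)
                → scaledProj N (a ℤ.+ t ℤ.* N) (u +[ t ] e) e ≡ scaledProj N a u e
scaledProj-line N a t [] [] = refl
scaledProj-line N a t (x ∷ u) (e ∷ es) = cong₂ _∷_ (identity N a t x e) (scaledProj-line N a t u es)
  where identity : ∀ N a t x e → N ℤ.* (x ℤ.+ t ℤ.* e) ℤ.- (a ℤ.+ t ℤ.* N) ℤ.* e ≡ N ℤ.* x ℤ.- a ℤ.* e
        identity = solve-∀

proj-line : ∀ {m} (ε : Pt m) → Dir ε → ∀ u t → proj ε (u +[ t ] ε) ≡ proj ε u
proj-line ε dir u t = begin
  proj ε (u +[ t ] ε)                                          ≡⟨ proj-scaled ε _ d N≡ ⟩
  divide d (scaledProj N (dot (u +[ t ] ε) ε) (u +[ t ] ε) ε)  ≡⟨ cong (λ a → divide d (scaledProj N a (u +[ t ] ε) ε)) dot≡ ⟩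
  divide d (scaledProj N (dot u ε ℤ.+ t ℤ.* N) (u +[ t ] ε) ε) ≡⟨ cong (divide d) (scaledProj-line N (dot u ε) t u ε) ⟩
  divide d (scaledProj N (dot u ε) u ε)                        ≡⟨ proj-scaled ε u d N≡ ⟨
  proj ε u                                                     ∎
  where
  open ≡-Reasoning
  d = proj₁ (Dir⇒selfDot-positive ε dir)
  N = + suc d
  selfDot≡ = proj₂ (Dir⇒selfDot-positive ε dir)
  N≡ = cong ∣_∣ selfDot≡
  dot≡ : dot (u +[ t ] ε) ε ≡ dot u ε ℤ.+ t ℤ.* N
  dot≡ = trans (dot-line u ε ε t) (cong (λ D → dot u ε ℤ.+ t ℤ.* D) selfDot≡)

multiple-at-unit : ∀ N a b x y e → e ℤ.* e ≡ + 1
  → N ℤ.* x ℤ.- a ℤ.* e ≡ N ℤ.* y ℤ.- b ℤ.* e → b ℤ.- a ≡ N ℤ.* ((y ℤ.- x) ℤ.* e)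
multiple-at-unit N a b x y e e²≡1 eq = begin
  b ℤ.- a                                        ≡⟨ ℤP.*-identityʳ (b ℤ.- a) ⟨
  (b ℤ.- a) ℤ.* + 1                              ≡⟨ cong ((b ℤ.- a) ℤ.*_) e²≡1 ⟨
  (b ℤ.- a) ℤ.* (e ℤ.* e)                         ≡⟨ expand N a b x y e ⟩
  M ℤ.+ ((N ℤ.* x ℤ.- a ℤ.* e) ℤ.- Q) ℤ.* e       ≡⟨ cong (λ P → M ℤ.+ (P ℤ.- Q) ℤ.* e) eq ⟩
  M ℤ.+ (Q ℤ.- Q) ℤ.* e                           ≡⟨ vanish M Q e ⟩
  M                                              ∎
  where
  open ≡-Reasoning
  M = N ℤ.* ((y ℤ.- x) ℤ.* e)
  Q = N ℤ.* y ℤ.- b ℤ.* e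
  expand : ∀ N a b x y e → (b ℤ.- a) ℤ.* (e ℤ.* e)
         ≡ N ℤ.* ((y ℤ.- x) ℤ.* e) ℤ.+ ((N ℤ.* x ℤ.- a ℤ.* e) ℤ.- (N ℤ.* y ℤ.- b ℤ.* e)) ℤ.* e
  expand = solve-∀
  vanish : ∀ M Q e → M ℤ.+ (Q ℤ.- Q) ℤ.* e ≡ M
  vanish = solve-∀

scaledProj-equal⇒multiple : ∀ {m} N a b (u v e : Pt m) → All Trit e → ¬ IsZeroVec e
  → scaledProj N a u e ≡ scaledProj N b v e → ∃ λ t → b ℤ.- a ≡ N ℤ.* t
scaledProj-equal⇒multiple N a b [] [] [] [] nonzero _ = ⊥-elim (nonzero [])
scaledProj-equal⇒multiple N a b (x ∷ u) (y ∷ v) (._ ∷ e) (inj₁ refl ∷ _) _ eq =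
  _ , multiple-at-unit N a b x y _ refl (proj₁ (∷-injective eq))
scaledProj-equal⇒multiple N a b (x ∷ u) (y ∷ v) (._ ∷ e) (inj₂ (inj₂ refl) ∷ _) _ eq =
  _ , multiple-at-unit N a b x y _ refl (proj₁ (∷-injective eq))
scaledProj-equal⇒multiple N a b (x ∷ u) (y ∷ v) (._ ∷ e) (inj₂ (inj₁ refl) ∷ ts) nonzero eq =
  scaledProj-equal⇒multiple N a b u v e ts (λ isZero → nonzero (refl ∷ isZero)) (proj₂ (∷-injective eq))

scaledProj-equal⇒on-line : ∀ {m} (u v e : Pt m) (d : ℕ) a b t → b ℤ.- a ≡ (+ suc d) ℤ.* t
  → scaledProj (+ suc d) a u e ≡ scaledProj (+ suc d) b v e → v ≡ u +[ t ] e
scaledProj-equal⇒on-line [] [] [] d a b t _ _ = refl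
scaledProj-equal⇒on-line (x ∷ u) (y ∷ v) (e ∷ es) d a b t b-a≡ eq =
  cong₂ _∷_ (ℤP.*-cancelˡ-≡ N y (x ℤ.+ t ℤ.* e) Ny≡)
            (scaledProj-equal⇒on-line u v es d a b t b-a≡ (proj₂ (∷-injective eq)))
  where
  open ≡-Reasoning
  N = + suc d
  split : ∀ N y b e → N ℤ.* y ≡ (N ℤ.* y ℤ.- b ℤ.* e) ℤ.+ b ℤ.* e
  split = solve-∀
  regroup : ∀ N x a b e → (N ℤ.* x ℤ.- a ℤ.* e) ℤ.+ b ℤ.* e ≡ N ℤ.* x ℤ.+ (b ℤ.- a) ℤ.* e
  regroup = solve-∀
  factor : ∀ N x t e → N ℤ.* x ℤ.+ N ℤ.* t ℤ.* e ≡ N ℤ.* (x ℤ.+ t ℤ.* e)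
  factor = solve-∀
  Ny≡ : N ℤ.* y ≡ N ℤ.* (x ℤ.+ t ℤ.* e)
  Ny≡ = begin
    N ℤ.* y                              ≡⟨ split N y b e ⟩
    (N ℤ.* y ℤ.- b ℤ.* e) ℤ.+ b ℤ.* e     ≡⟨ cong (ℤ._+ b ℤ.* e) (proj₁ (∷-injective eq)) ⟨
    (N ℤ.* x ℤ.- a ℤ.* e) ℤ.+ b ℤ.* e     ≡⟨ regroup N x a b e ⟩
    N ℤ.* x ℤ.+ (b ℤ.- a) ℤ.* e           ≡⟨ cong (λ z → N ℤ.* x ℤ.+ z ℤ.* e) b-a≡ ⟩
    N ℤ.* x ℤ.+ N ℤ.* t ℤ.* e             ≡⟨ factor N x t e ⟩
    N ℤ.* (x ℤ.+ t ℤ.* e)                 ∎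

proj-equal⇒on-line : ∀ {m} (ε : Pt m) → Dir ε → ∀ u v → proj ε u ≡ proj ε v
                   → ∃ λ t → v ≡ u +[ t ] ε
proj-equal⇒on-line ε dir@(trits , nonzero) u v eq =
  t , scaledProj-equal⇒on-line u v ε d (dot u ε) (dot v ε) t b-a≡ scaled≡
  where
  d = proj₁ (Dir⇒selfDot-positive ε dir)
  N≡ = cong ∣_∣ (proj₂ (Dir⇒selfDot-positive ε dir))
  scaled≡ = divide-injective d _ _
    (trans (sym (proj-scaled ε u d N≡)) (trans eq (proj-scaled ε v d N≡)))
  multiple = scaledProj-equal⇒multiple (+ suc d) (dot u ε) (dot v ε) u v ε trits nonzero scaled≡
  t = proj₁ multiple
  b-a≡ = proj₂ multiple

trits-block : ∀ {n} → Pt n → List (Pt (suc n))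
trits-block v = (-[1+ 0 ] ∷ v) ∷ (+ 0 ∷ v) ∷ (+ 1 ∷ v) ∷ []

trits-block-tail : ∀ {n} {v : Pt n} {w} → w ∈ trits-block v → Vec.tail w ≡ v
trits-block-tail (here refl) = refl
trits-block-tail (there (here refl)) = refl
trits-block-tail (there (there (here refl))) = refl

tritVecs-complete : ∀ {n} (v : Pt n) → All Trit v → v ∈ tritVecs n
tritVecs-complete [] [] = here refl
tritVecs-complete {suc n} (a ∷ v) (t ∷ ts) =
  ∈-concatMap⁺ trits-block {xs = tritVecs n} (Any.map (λ { refl → in-block t }) (tritVecs-complete v ts))
  where
  in-block : ∀ {a} → Trit a → (a ∷ v) ∈ trits-block v
  in-block (inj₁ refl) = here refl
  in-block (inj₂ (inj₁ refl)) = there (here refl)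
  in-block (inj₂ (inj₂ refl)) = there (there (here refl))

tritVecs-sound : ∀ {n} (v : Pt n) → v ∈ tritVecs n → All Trit v
tritVecs-sound [] _ = []
tritVecs-sound {suc n} v v∈ with find (∈-concatMap⁻ trits-block {xs = tritVecs n} v∈)
... | w , w∈ , v∈block = extend v∈block (tritVecs-sound w w∈)
  where
  extend : ∀ {w v} → v ∈ trits-block w → All Trit w → All Trit v
  extend (here refl) ts = inj₁ refl ∷ ts
  extend (there (here refl)) ts = inj₂ (inj₁ refl) ∷ ts
  extend (there (there (here refl))) ts = inj₂ (inj₂ refl) ∷ ts

tritVecs-unique : ∀ n → Unique (tritVecs n)
tritVecs-unique zero = [] ∷ []
tritVecs-unique (suc n) =
  concatMap-unique trits-block (tritVecs-unique n)
    (λ _ → ((λ ()) ∷ (λ ()) ∷ []) ∷ ((λ ()) ∷ []) ∷ [] ∷ [])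
    (λ w∈ w∈′ → trans (sym (trits-block-tail w∈)) (trits-block-tail w∈′))

isNonzero? : ∀ {n} (v : Pt n) → Dec (¬ IsZeroVec v)
isNonzero? v = ¬? (all? (ℤ._≟ + 0) v)

nonzeroDirs-complete : ∀ {n} (v : Pt n) → Dir v → v ∈ nonzeroDirs n
nonzeroDirs-complete v (trits , nonzero) = ∈-filter⁺ isNonzero? (tritVecs-complete v trits) nonzero

nonzeroDirs-sound : ∀ {n} (v : Pt n) → v ∈ nonzeroDirs n → Dir v
nonzeroDirs-sound {n} v v∈ with ∈-filter⁻ isNonzero? {xs = tritVecs n} v∈
... | v∈trits , nonzero = tritVecs-sound v v∈trits , nonzero

nonzeroDirs-unique : ∀ n → Unique (nonzeroDirs n)
nonzeroDirs-unique n = UniqueP.filter⁺ isNonzero? (tritVecs-unique n)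

-- Exits of a finite set, and how they count boundary edges and projections

module Exits {n : ℕ} (S : List (Pt n)) where

  _≟ᵥ_ : (u v : Pt n) → Dec (u ≡ v)
  _≟ᵥ_ = ≡-dec ℤ._≟_

  open import Data.List.Membership.DecPropositional _≟ᵥ_ using (_∈?_)
  open import Data.List.Relation.Unary.Unique.DecPropositional.Properties _≟ᵥ_
    using (deduplicate-!)

  leaves? : (ε x : Pt n) → Dec (¬ ((x ⊕ ε) ∈ S))
  leaves? ε x = ¬? ((x ⊕ ε) ∈? S)

  exits : Pt n → List (Pt n)
  exits ε = filter (leaves? ε) (deduplicate _≟ᵥ_ S)

  exit-sound : ∀ {ε x} → x ∈ exits ε → x ∈ S × ¬ ((x ⊕ ε) ∈ S)
  exit-sound {ε} x∈ with ∈-filter⁻ (leaves? ε) {xs = deduplicate _≟ᵥ_ S} x∈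
  ... | x∈dedup , leaves = ∈-deduplicate⁻ _≟ᵥ_ S x∈dedup , leaves

  exit-complete : ∀ {ε x} → x ∈ S → ¬ ((x ⊕ ε) ∈ S) → x ∈ exits ε
  exit-complete {ε} x∈S leaves = ∈-filter⁺ (leaves? ε) (∈-deduplicate⁺ _≟ᵥ_ x∈S) leaves

  exits-unique : ∀ ε → Unique (exits ε)
  exits-unique ε = UniqueP.filter⁺ (leaves? ε) (deduplicate-! S)

  exitEdge : Pt n → Pt n → Pt n × Pt n
  exitEdge ε x = x , x ⊕ ε

  exitEdges : Pt n → List (Pt n × Pt n)
  exitEdges ε = map (exitEdge ε) (exits ε)

  boundaryEdges : List (Pt n × Pt n)
  boundaryEdges = concatMap exitEdges (nonzeroDirs n)

  -- An edge determines its direction, so the groups are disjoint.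
  boundaryEdges-unique : Unique boundaryEdges
  boundaryEdges-unique =
    concatMap-unique exitEdges (nonzeroDirs-unique n)
      (λ ε → map-unique (exitEdge ε) (exits-unique ε) (λ _ _ → cong proj₁))
      same-direction
    where
    same-direction : ∀ {ε ε′ b} → b ∈ exitEdges ε → b ∈ exitEdges ε′ → ε ≡ ε′
    same-direction {ε} {ε′} b∈ b∈′ with ∈-map⁻ (exitEdge ε) b∈ | ∈-map⁻ (exitEdge ε′) b∈′
    ... | x , _ , refl | x′ , _ , same =
      trans (sym (⊕-⊖-direction x ε))
            (trans (cong₂ _⊖_ (cong proj₂ same) (cong proj₁ same)) (⊕-⊖-direction x′ ε′))

  -- Adjacent points differ by a direction, so every boundary edge is listed.
  boundaryEdges-correct : ∀ e → e ∈ boundaryEdges ⇔ InEdgeBoundary S e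
  boundaryEdges-correct (x , y) = mk⇔ sound complete
    where
    sound : (x , y) ∈ boundaryEdges → InEdgeBoundary S (x , y)
    sound e∈ with find (∈-concatMap⁻ exitEdges {xs = nonzeroDirs n} e∈)
    ... | ε , ε∈ , e∈ε with ∈-map⁻ (exitEdge ε) e∈ε
    ... | x , x∈ , refl =
      trans (supNorm-⊖-comm x (x ⊕ ε))
            (trans (cong supNorm (⊕-⊖-direction x ε)) (Dir⇒supNorm≡1 ε (nonzeroDirs-sound ε ε∈)))
      , exit-sound x∈
    complete : InEdgeBoundary S (x , y) → (x , y) ∈ boundaryEdges
    complete (adjacent , x∈S , y∉S) =
      ∈-concatMap⁺ exitEdges {xs = nonzeroDirs n}
        (Any.map (λ { refl → edge∈ }) (nonzeroDirs-complete ε dir))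
      where
      ε = y ⊖ x
      dir = supNorm≡1⇒Dir ε (trans (supNorm-⊖-comm y x) adjacent)
      edge∈ : (x , y) ∈ exitEdges ε
      edge∈ = subst (λ z → (x , z) ∈ exitEdges ε) (⊕-⊖-difference x y)
                (∈-map⁺ (exitEdge ε) (exit-complete x∈S (subst (λ z → ¬ (z ∈ S)) (sym (⊕-⊖-difference x y)) y∉S)))

  boundaryEdges-count : length boundaryEdges ≡ sum (map (length ∘ exits) (nonzeroDirs n))
  boundaryEdges-count = begin
    length (concatMap exitEdges (nonzeroDirs n))   ≡⟨ length-concatMap exitEdges (nonzeroDirs n) ⟩
    sum (map (length ∘ exitEdges) (nonzeroDirs n)) ≡⟨ cong sum (map-cong (λ ε → length-map (exitEdge ε) (exits ε)) (nonzeroDirs n)) ⟩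
    sum (map (length ∘ exits) (nonzeroDirs n))     ∎
    where open ≡-Reasoning

  -- Along the line u + jε the value ⟨·,ε⟩ grows by ‖ε‖² per step, while it is
  -- bounded on S; so the line stays in S for at most `bound` steps.
  module Walk (ε : Pt n) (dir : Dir ε) (u : Pt n) where

    bound : ℕ
    bound = sum (map (λ w → ∣ dot w ε ∣) S) ℕ.+ ∣ dot u ε ∣

    line-leaves-S : ∀ j → (u +[ + j ] ε) ∈ S → j ℕ.≤ bound
    line-leaves-S j w∈S = begin
      j                                        ≤⟨ ℕP.m≤m*n j (suc d) ⟩
      ∣ + (j ℕ.* suc d) ∣                        ≡⟨ cong ∣_∣ gain ⟩
      ∣ dot w ε ℤ.- dot u ε ∣                    ≤⟨ ℤP.∣i+j∣≤∣i∣+∣j∣ (dot w ε) (ℤ.- dot u ε) ⟩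
      ∣ dot w ε ∣ ℕ.+ ∣ ℤ.- dot u ε ∣            ≡⟨ cong (∣ dot w ε ∣ ℕ.+_) (ℤP.∣-i∣≡∣i∣ (dot u ε)) ⟩
      ∣ dot w ε ∣ ℕ.+ ∣ dot u ε ∣                ≤⟨ ℕP.+-monoˡ-≤ ∣ dot u ε ∣ (member≤sum (λ v → ∣ dot v ε ∣) S w∈S) ⟩
      bound                                    ∎
      where
      open ℕP.≤-Reasoning
      w = u +[ + j ] ε
      d = proj₁ (Dir⇒selfDot-positive ε dir)
      difference : ∀ p J → J ≡ (p ℤ.+ J) ℤ.- p
      difference = solve-∀
      gain : + (j ℕ.* suc d) ≡ dot w ε ℤ.- dot u ε
      gain = trans (difference (dot u ε) _)
        (cong (ℤ._- dot u ε) (sym (trans (dot-line u ε ε (+ j))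
          (trans (cong (λ D → dot u ε ℤ.+ + j ℤ.* D) (proj₂ (Dir⇒selfDot-positive ε dir)))
                 (cong (λ s → dot u ε ℤ.+ s) (sym (ℤP.pos-* j (suc d))))))))

    -- Step along the line while staying in S; `fuel` more steps always suffice.
    walk : (fuel j : ℕ) → (u +[ + j ] ε) ∈ S → suc bound ℕ.≤ j ℕ.+ fuel
         → ∃ λ k → (u +[ + k ] ε) ∈ exits ε
    walk zero j w∈S enough =
      ⊥-elim (ℕP.<-irrefl refl (ℕP.≤-trans (subst (suc bound ℕ.≤_) (ℕP.+-identityʳ j) enough) (line-leaves-S j w∈S)))
    walk (suc fuel) j w∈S enough with ((u +[ + j ] ε) ⊕ ε) ∈? S
    ... | yes next∈S = walk fuel (suc j) (subst (_∈ S) (line-step j u ε) next∈S)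
                            (subst (suc bound ℕ.≤_) (ℕP.+-suc j fuel) enough)
    ... | no next∉S = j , exit-complete w∈S next∉S

  exit-on-line : ∀ ε → Dir ε → ∀ {u} → u ∈ S → ∃ λ k → (u +[ + k ] ε) ∈ exits ε
  exit-on-line ε dir {u} u∈S =
    Walk.walk ε dir u (suc (Walk.bound ε dir u)) 0 (subst (_∈ S) (sym (line-zero u ε)) u∈S) ℕP.≤-refl

  module GapFree (gap-free : ∀ ε → Dir ε → ∀ x → ¬ InGap ε S x) where

    -- Exits x and x + jε (j ≥ 0) coincide: j = 1 contradicts x + ε ∉ S, and
    -- for j ≥ 2 the point x + ε lies in gap_ε(S).

    exits-forward : ∀ ε → Dir ε → ∀ {x x′} → x ∈ exits ε → x′ ∈ exits ε
                  → (j : ℕ) → x′ ≡ x +[ + j ] ε → x ≡ x′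
    exits-forward ε dir {x} _ _ zero x′≡ = sym (trans x′≡ (line-zero x ε))
    exits-forward ε dir {x} x∈ x′∈ (suc zero) x′≡ =
      ⊥-elim (proj₂ (exit-sound x∈) (subst (_∈ S) next≡ (proj₁ (exit-sound x′∈))))
      where
      next≡ : _ ≡ x ⊕ ε
      next≡ = trans x′≡ (trans (sym (line-step 0 x ε)) (cong (_⊕ ε) (line-zero x ε)))
    exits-forward ε dir {x} x∈ x′∈ (suc (suc b)) x′≡ =
      ⊥-elim (gap-free ε dir (x ⊕ ε)
        ( subst (_∈ S) (sym (⊕-⊖-cancel x ε)) (proj₁ (exit-sound x∈))
        , proj₂ (exit-sound x∈)
        , suc b , s≤s z≤n
        , subst (_∈ S) (trans x′≡ (sym (line-from-next (suc b) x ε))) (proj₁ (exit-sound x′∈))))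

    proj-injective-on-exits : ∀ ε → Dir ε → ∀ {x x′} → x ∈ exits ε → x′ ∈ exits ε
                            → proj ε x ≡ proj ε x′ → x ≡ x′
    proj-injective-on-exits ε dir {x} {x′} x∈ x′∈ same with proj-equal⇒on-line ε dir x x′ same
    ... | + j , x′≡ = exits-forward ε dir x∈ x′∈ j x′≡
    ... | -[1+ k ] , x′≡ = sym (exits-forward ε dir x′∈ x∈ (suc k)
            (trans (sym (line-back -[1+ k ] x ε)) (cong (_+[ + suc k ] ε) (sym x′≡))))

    projection-size : ∀ ε → Dir ε → HasSize (InProj ε S) (length (exits ε))
    projection-size ε dir =
      map (proj ε) (exits ε)
      , map-unique (proj ε) (exits-unique ε) (proj-injective-on-exits ε dir)
      , (λ q → mk⇔ (sound q) (complete q))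
      , length-map (proj ε) (exits ε)
      where
      sound : ∀ q → q ∈ map (proj ε) (exits ε) → InProj ε S q
      sound q q∈ with ∈-map⁻ (proj ε) q∈
      ... | x , x∈ , q≡ = x , proj₁ (exit-sound x∈) , sym q≡
      complete : ∀ q → InProj ε S q → q ∈ map (proj ε) (exits ε)
      complete q (u , u∈S , refl) with exit-on-line ε dir u∈S
      ... | k , exit∈ = subst (_∈ map (proj ε) (exits ε)) (proj-line ε dir u (+ k)) (∈-map⁺ (proj ε) exit∈)

corollary1 : (n : ℕ) → 1 ≤ n → (S : List (Pt n))
    → (∀ ε → Dir ε → ∀ x → ¬ InGap ε S x)
    → Σ ℕ λ m → HasSize (InEdgeBoundary S) m
    × Σ (Pt n → ℕ) λ k → (∀ ε → Dir ε → HasSize (InProj ε S) (k ε))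
    × m ≡ sum (map k (nonzeroDirs n))
corollary1 n _ S gap-free =
  length boundaryEdges
  , (boundaryEdges , boundaryEdges-unique , boundaryEdges-correct , refl)
  , length ∘ exits
  , projection-size
  , boundaryEdges-count
  where
  open Exits S
  open GapFree gap-free
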